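{- Let $\Sigma$ be a finite alphabet with $\sigma=|\Sigma|$, $k\in\mathbb{N}$ and $w\in\Sigma^{\ast}$. Then $|\operatorname{ScatFact}_k(w)|=\sigma^k-1$ if and only if $\iota(w)=k-1$, $|\operatorname{alph}(\operatorname{r}(w))|=\sigma-1$, and the word $w'=(\operatorname{ar}_2(w^R)\cdots\operatorname{ar}_{k-1}(w^R)\operatorname{r}(w^R))^R$ satisfies $|\operatorname{ScatFact}_{k-1}(w')|=\sigma^{k-1}-1$.
   Context: $\operatorname{alph}(w)$ is the set of letters of $w$; $w^R$ is the reversal of $w$; $\operatorname{ScatFact}_k(w)$ is the set of length-$k$ scattered factors (subsequences) of $w$. Arch factorisation: $w=\operatorname{ar}_1(w)\cdots\operatorname{ar}_{\iota(w)}(w)\operatorname{r}(w)$ where $\operatorname{ar}_1(w)$ is the shortest prefix containing all letters of $\Sigma$, each subsequent arch is the shortest prefix of the remaining suffix containing all letters of $\Sigma$, $\iota(w)$ is the number of arches, and the rest $\operatorname{r}(w)$ does not contain all letters of $\Sigma$. -}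

module Defs where

open import Data.Nat using (ℕ; zero; suc)
open import Data.Fin using (Fin)
open import Data.Fin.Properties using (_≟_)
open import Data.List using (List; []; _∷_; _++_; map; concatMap; concat; filter; length; reverse; take; drop; allFin)
open import Data.List.Relation.Unary.All using (all?)
open import Data.List.Relation.Unary.Any using (any?)
open import Data.List.Relation.Binary.Sublist.Propositional using (_⊆_)
import Data.List.Relation.Binary.Sublist.DecPropositional as SubDec
open import Data.Product using (_×_; _,_; proj₁; proj₂)
open import Relation.Binary.PropositionalEquality using (_≡_)
open import Relation.Nullary.Decidable using (Dec; yes; no; ⌊_⌋)
open import Data.Bool using (Bool; true; false; if_then_else_)

-- The alphabet Σ is Fin σ (σ = |Σ|); words are lists of letters.
Word : ℕ → Set
Word σ = List (Fin σ)

_∈?ʷ_ : ∀ {σ} (a : Fin σ) (w : Word σ) → Dec (Data.List.Relation.Unary.Any.Any (a ≡_) w)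
a ∈?ʷ w = any? (a ≟_) w

allWords : (σ : ℕ) → ℕ → List (Word σ)
allWords σ zero    = [] ∷ []
allWords σ (suc k) = concatMap (λ a → map (a ∷_) (allWords σ k)) (allFin σ)

-- |ScatFact_k(w)|: number of words u of length k that are scattered factors
-- (subsequences, stdlib sublist relation _⊆_) of w
numScatFact : ∀ {σ} → ℕ → Word σ → ℕ
numScatFact {σ} k w = length (filter (λ u → SubDec._⊆?_ _≟_ u w) (allWords σ k))

numAlph : ∀ {σ} → Word σ → ℕ
numAlph {σ} w = length (filter (λ a → a ∈?ʷ w) (allFin σ))

complete : ∀ {σ} → Word σ → Bool
complete {σ} w = ⌊ all? (λ a → a ∈?ʷ w) (allFin σ) ⌋

-- Arch factorisation.  archGo cur w : cur is the (reversed) current partial arch.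
-- Each arch is the shortest prefix of the remaining word containing all letters.
archGo : ∀ {σ} → Word σ → Word σ → List (Word σ) × Word σ
archGo cur [] = [] , reverse cur
archGo cur (a ∷ w) with complete (a ∷ cur)
... | true  = let r = archGo [] w in (reverse (a ∷ cur) ∷ proj₁ r) , proj₂ r
... | false = archGo (a ∷ cur) w

arches : ∀ {σ} → Word σ → List (Word σ)
arches w = proj₁ (archGo [] w)

ι : ∀ {σ} → Word σ → ℕ
ι w = length (arches w)

rest : ∀ {σ} → Word σ → Word σ
rest w = proj₂ (archGo [] w)

-- w' = (ar_2(w^R) ⋯ ar_{k-1}(w^R) r(w^R))^R
--   (arches with indices 2..k-1 of w^R, i.e. drop 1 then take k-2)
w′ : ∀ {σ} → ℕ → Word σ → Word σ
w′ k w = reverse (concat (take (k Data.Nat.∸ 2) (drop 1 (arches (reverse w)))) ++ rest (reverse w))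

-- A word misses σ^k − 1 scattered factors of length k exactly when exactly one word of length k is
-- absent from it.  Every word of length at most ι(w) is a scattered factor of w, whereas the word
-- formed by the last letters of the arches of w followed by a letter b ∉ alph(r(w)) is not.  Hence a
-- unique absent word of length k forces ι(w) = k − 1 (over two or more letters, an absent shorter word
-- would have several absent extensions of length k) and a unique letter missing from r(w).  Reading w
-- backwards, w = w′·c·Y where c·Y is the first arch of w^R reversed, so c ∉ Y and alph(c·Y) = Σ: if
-- u·d is absent from w then u is absent from w′, and if u is absent from w′ then u·c is absent from w.
-- This transfers the uniqueness of the absent word between w and w′.
module Submission where

open import Defs
open import Data.Bool using (true; false)
open import Data.Bool.Properties using (T-≡)
open import Data.Fin using (Fin; zero; suc)
open import Data.Fin.Properties using (_≟_; ¬∀⟶∃¬)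
open import Data.List
  using (List; []; _∷_; [_]; _++_; _∷ʳ_; _ʳ++_; map; concat; concatMap; filter; length; allFin; reverse; replicate; take; initLast; _∷ʳ′_)
open import Data.List.Properties
  using (length-++; length-map; length-replicate; length-reverse; length-tabulate; ++-assoc; ++-cancelˡ; ∷-injectiveˡ; ∷-injectiveʳ; ∷ʳ-injectiveˡ; ∷ʳ-injectiveʳ; reverse-++; reverse-involutive; unfold-reverse; take-all; ʳ++-defn)
open import Data.List.Membership.Propositional using (_∈_; _∉_)
open import Data.List.Membership.Propositional.Properties
  using (∈-filter⁺; ∈-filter⁻; ∈-allFin; ∈-map⁺; ∈-map⁻; ∈-concat⁺′; ∈-concat⁻′; ∈-++⁻)
open import Data.List.Relation.Unary.All as All using (All)
import Data.List.Relation.Unary.All.Properties as All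
open import Data.List.Relation.Unary.Any using (here; there)
import Data.List.Relation.Unary.Any.Properties as Any
import Data.List.Relation.Unary.AllPairs as AllPairs
import Data.List.Relation.Unary.AllPairs.Properties as AllPairs
open import Data.List.Relation.Unary.Unique.Propositional using (Unique)
import Data.List.Relation.Unary.Unique.Propositional.Properties as Unique
open import Data.List.Relation.Binary.Disjoint.Propositional using (Disjoint)
open import Data.List.Relation.Binary.Pointwise using (Pointwise; []; _∷_; Pointwise-length)
open import Data.List.Relation.Binary.Sublist.Propositional using (_⊆_; minimum; from∈; to∈; ⊆-refl; ⊆-trans)
open import Data.List.Relation.Binary.Sublist.Propositional.Properties
  using (∷⁻; ∷ʳ⁻; ++⁺; ++⁺ˡ; ++⁺ʳ; reverse⁺; reverse⁻)
import Data.List.Relation.Binary.Sublist.DecPropositional as SublistDec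
open import Data.Nat using (ℕ; zero; suc; _+_; _*_; _^_; _∸_; _≤_; _<_; s≤s; NonZero; >-nonZero⁻¹)
open import Data.Nat.Properties
  using (+-comm; +-suc; 1+n≢n; m≢1+n+m; m^n>0; m+[n∸m]≡n; ≤-antisym; ≤-trans; ≤-reflexive; ≮⇒≥; suc-injective)
open import Data.Product using (∃; ∃₂; ∃!; _×_; _,_; proj₁; proj₂)
open import Data.Product.Function.NonDependent.Propositional using (_×-⇔_)
open import Data.Sum using (inj₁; inj₂)
open import Function using (_∘_; case_of_)
open import Function.Bundles using (_⇔_; mk⇔; Equivalence)
open import Function.Construct.Composition using (_⇔-∘_)
open import Function.Construct.Identity using (⇔-id)
open import Function.Construct.Symmetry using (⇔-sym)
import Function.Related.Propositional as Related
open import Relation.Binary.Definitions using (DecidableEquality)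
open import Relation.Binary.PropositionalEquality
  using (_≡_; _≢_; refl; sym; trans; cong; cong₂; subst; subst₂; module ≡-Reasoning)
open import Relation.Nullary using (¬_; yes; no; contradiction)
open import Relation.Nullary.Decidable using (toWitness; fromWitness; decidable-stable)
open import Relation.Unary using (Decidable)
open import Relation.Unary.Properties using (∁?)

∃!-cong : ∀ {A : Set} {B C : A → Set} → (∀ x → B x ⇔ C x) → ∃! _≡_ B ⇔ ∃! _≡_ C
∃!-cong B⇔C = mk⇔
  (λ (x , Bx , x!) → x , Equivalence.to (B⇔C x) Bx , x! ∘ Equivalence.from (B⇔C _))
  (λ (x , Cx , x!) → x , Equivalence.from (B⇔C x) Cx , x! ∘ Equivalence.to (B⇔C _))

m≡n+m∸1⇔n≡1 : ∀ m n → 0 < n + m → m ≡ n + m ∸ 1 ⇔ n ≡ 1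
m≡n+m∸1⇔n≡1 (suc m) zero          _ = mk⇔ (λ eq → contradiction eq 1+n≢n) λ ()
m≡n+m∸1⇔n≡1 m       (suc zero)    _ = mk⇔ (λ _ → refl) (λ _ → refl)
m≡n+m∸1⇔n≡1 m       (suc (suc n)) _ = mk⇔ (λ eq → contradiction eq (m≢1+n+m m)) λ ()

module _ {A : Set} where

  length≡1⇔∃!∈ : ∀ {xs : List A} → Unique xs → length xs ≡ 1 ⇔ ∃! _≡_ (_∈ xs)
  length≡1⇔∃!∈ {xs} xs-unique = mk⇔ (to xs) (from xs-unique)
    where
    to : ∀ xs → length xs ≡ 1 → ∃! _≡_ (_∈ xs)
    to (x ∷ []) _ = x , here refl , λ { (here x≡y) → sym x≡y }
    from : ∀ {xs} → Unique xs → ∃! _≡_ (_∈ xs) → length xs ≡ 1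
    from {x ∷ []}    _                              _             = refl
    from {x ∷ y ∷ _} ((x≢y All.∷ _) AllPairs.∷ _) (z , _ , z!) =
      contradiction (trans (sym (z! (here refl))) (z! (there (here refl)))) x≢y

  module _ {P : A → Set} (P? : Decidable P) where

    length-filter-∁+length-filter : ∀ xs → length (filter (∁? P?) xs) + length (filter P? xs) ≡ length xs
    length-filter-∁+length-filter []       = refl
    length-filter-∁+length-filter (x ∷ xs) with P? x
    ... | yes _ = trans (+-suc _ _) (cong suc (length-filter-∁+length-filter xs))
    ... | no  _ = cong suc (length-filter-∁+length-filter xs)

    length-filter≡length∸1⇔∃!¬ : ∀ {xs} → Unique xs → 0 < length xs →
      length (filter P? xs) ≡ length xs ∸ 1 ⇔ ∃! _≡_ (λ x → x ∈ xs × ¬ P x)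
    length-filter≡length∸1⇔∃!¬ {xs} xs-unique 0<|xs|
      rewrite sym (length-filter-∁+length-filter xs) =
      ∃!-cong (λ _ → mk⇔ (∈-filter⁻ (∁? P?)) λ (x∈xs , ¬Px) → ∈-filter⁺ (∁? P?) x∈xs ¬Px)
        ⇔-∘ (length≡1⇔∃!∈ (Unique.filter⁺ (∁? P?) xs-unique) ⇔-∘ m≡n+m∸1⇔n≡1 _ _ 0<|xs|)

  Complete : List A → Set
  Complete w = ∀ x → x ∈ w

  Absent : ℕ → List A → List A → Set
  Absent k w u = length u ≡ k × ¬ u ⊆ w

  ExactlyOneAbsent : ℕ → List A → Set
  ExactlyOneAbsent k w = ∃! _≡_ (Absent k w)

module _ {σ : ℕ} where

  length-allFin : length (allFin σ) ≡ σ
  length-allFin = length-tabulate (λ i → i)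

  length-allWords : ∀ k → length (allWords σ k) ≡ σ ^ k
  length-allWords zero    = refl
  length-allWords (suc k) = begin
    length (concatMap (λ a → map (a ∷_) (allWords σ k)) (allFin σ)) ≡⟨ length-concatMap (allFin σ) ⟩
    length (allFin σ) * σ ^ k                                         ≡⟨ cong (_* σ ^ k) length-allFin ⟩
    σ * σ ^ k                                                         ∎
    where
    open ≡-Reasoning
    length-concatMap : ∀ as → length (concatMap (λ a → map (a ∷_) (allWords σ k)) as) ≡ length as * σ ^ k
    length-concatMap []       = refl
    length-concatMap (a ∷ as) = trans (length-++ (map (a ∷_) (allWords σ k)))
      (cong₂ _+_ (trans (length-map (a ∷_) (allWords σ k)) (length-allWords k)) (length-concatMap as))

  unique-allWords : ∀ k → Unique (allWords σ k)
  unique-allWords zero    = All.[] AllPairs.∷ AllPairs.[]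
  unique-allWords (suc k) = Unique.concat⁺
    (All.map⁺ (All.tabulate λ _ → Unique.map⁺ ∷-injectiveʳ (unique-allWords k)))
    (AllPairs.map⁺ (AllPairs.map disjoint (Unique.allFin⁺ σ)))
    where
    disjoint : ∀ {a b} → a ≢ b → Disjoint (map (a ∷_) (allWords σ k)) (map (b ∷_) (allWords σ k))
    disjoint a≢b (∈a , ∈b) with ∈-map⁻ _ ∈a | ∈-map⁻ _ ∈b
    ... | _ , _ , refl | _ , _ , eq = a≢b (∷-injectiveˡ eq)

  ∈-allWords⇔ : ∀ k (u : Word σ) → u ∈ allWords σ k ⇔ length u ≡ k
  ∈-allWords⇔ k u = mk⇔ (to k) λ { refl → from u }
    where
    to : ∀ k {u} → u ∈ allWords σ k → length u ≡ k
    to zero    (here refl) = refl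
    to (suc k) u∈ with ∈-concat⁻′ (map (λ a → map (a ∷_) (allWords σ k)) (allFin σ)) u∈
    ... | _ , u∈as , as∈ with ∈-map⁻ (λ a → map (a ∷_) (allWords σ k)) as∈
    ... | a , _ , refl with ∈-map⁻ (a ∷_) u∈as
    ... | v , v∈ , refl = cong suc (to k v∈)
    from : ∀ u → u ∈ allWords σ (length u)
    from []      = here refl
    from (a ∷ u) = ∈-concat⁺′ (∈-map⁺ (a ∷_) (from u)) (∈-map⁺ _ (∈-allFin a))

  module _ .{{_ : NonZero σ}} where

    numScatFact≡σ^k∸1⇔exactlyOneAbsent : ∀ k (w : Word σ) →
      numScatFact k w ≡ σ ^ k ∸ 1 ⇔ ExactlyOneAbsent k w
    numScatFact≡σ^k∸1⇔exactlyOneAbsent k w rewrite sym (length-allWords k) =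
      ∃!-cong (λ u → ∈-allWords⇔ k u ×-⇔ ⇔-id _)
        ⇔-∘ length-filter≡length∸1⇔∃!¬ (λ u → SublistDec._⊆?_ _≟_ u w) (unique-allWords k)
              (subst (0 <_) (sym (length-allWords k)) (m^n>0 σ k))

    numAlph≡σ∸1⇔∃!∉ : ∀ (r : Word σ) → numAlph r ≡ σ ∸ 1 ⇔ ∃! _≡_ (_∉ r)
    numAlph≡σ∸1⇔∃!∉ r = subst (λ n → numAlph r ≡ n ∸ 1 ⇔ ∃! _≡_ (_∉ r)) length-allFin
      (∃!-cong (λ a → mk⇔ proj₂ (∈-allFin a ,_))
        ⇔-∘ length-filter≡length∸1⇔∃!¬ (_∈?ʷ r) (Unique.allFin⁺ σ)
              (subst (0 <_) (sym length-allFin) (>-nonZero⁻¹ σ)))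

module _ {A : Set} where

  length-∷ʳ : ∀ (xs : List A) x → length (xs ∷ʳ x) ≡ suc (length xs)
  length-∷ʳ xs x = trans (length-++ xs) (+-comm (length xs) 1)

  completing-∉ : ∀ {a : A} {xs} → ¬ Complete xs → Complete (a ∷ xs) → a ∉ xs
  completing-∉ xs-incomplete a∷xs-complete a∈xs = xs-incomplete λ x →
    case a∷xs-complete x of λ where
      (here refl)  → a∈xs
      (there x∈xs) → x∈xs

  ∷⊆++∷⇒⊆ : ∀ {c : A} {u Z} X → c ∉ X → c ∷ u ⊆ X ++ c ∷ Z → u ⊆ Z
  ∷⊆++∷⇒⊆ []      _   p = ∷⁻ p
  ∷⊆++∷⇒⊆ (x ∷ X) c∉X p = ∷⊆++∷⇒⊆ X (c∉X ∘ there) (∷ʳ⁻ (c∉X ∘ here) p)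

  ∷ʳ⊆++∷⇒⊆ : ∀ {c : A} {u Y} P → c ∉ Y → u ∷ʳ c ⊆ P ++ c ∷ Y → u ⊆ P
  ∷ʳ⊆++∷⇒⊆ {c} {u} {Y} P c∉Y p = reverse⁻ (∷⊆++∷⇒⊆ (reverse Y) (c∉Y ∘ Any.reverse⁻) p′)
    where
    reverse-++-∷ : reverse (P ++ c ∷ Y) ≡ reverse Y ++ c ∷ reverse P
    reverse-++-∷ = begin
      reverse (P ++ c ∷ Y)            ≡⟨ reverse-++ P (c ∷ Y) ⟩
      reverse (c ∷ Y) ++ reverse P    ≡⟨ cong (_++ reverse P) (unfold-reverse c Y) ⟩
      (reverse Y ∷ʳ c) ++ reverse P   ≡⟨ ++-assoc (reverse Y) [ c ] (reverse P) ⟩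
      reverse Y ++ c ∷ reverse P      ∎
      where open ≡-Reasoning
    p′ : c ∷ reverse u ⊆ reverse Y ++ c ∷ reverse P
    p′ = subst₂ _⊆_ (reverse-++ u [ c ]) reverse-++-∷ (reverse⁺ p)

  absent-prefix : ∀ {m P S u} {d : A} → Complete S → Absent (suc m) (P ++ S) (u ∷ʳ d) → Absent m P u
  absent-prefix {u = u} {d} S-complete (|ud|≡1+m , ud⊈) =
    suc-injective (trans (sym (length-∷ʳ u d)) |ud|≡1+m) , λ u⊆P → ud⊈ (++⁺ u⊆P (from∈ (S-complete d)))

  absent-extend : ∀ {m P Y u} {c : A} → c ∉ Y → Absent m P u → Absent (suc m) (P ++ c ∷ Y) (u ∷ʳ c)
  absent-extend {P = P} {u = u} {c} c∉Y (|u|≡m , u⊈) =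
    trans (length-∷ʳ u c) (cong suc |u|≡m) , u⊈ ∘ ∷ʳ⊆++∷⇒⊆ P c∉Y

  exactlyOneAbsent-prefix : ∀ {m P Y} {c : A} → c ∉ Y → Complete (c ∷ Y) →
    ExactlyOneAbsent (suc m) (P ++ c ∷ Y) → ExactlyOneAbsent m P
  exactlyOneAbsent-prefix c∉Y cY-complete (u₀ , u₀-absent , u₀!) with initLast u₀
  ... | []      = contradiction (proj₁ u₀-absent) λ ()
  ... | u ∷ʳ′ d = u , absent-prefix cY-complete u₀-absent ,
                  λ v-absent → ∷ʳ-injectiveˡ u _ (u₀! (absent-extend c∉Y v-absent))

  module _ (_≟ᴬ_ : DecidableEquality A) where
    open SublistDec _≟ᴬ_ using (_⊆?_)

    -- An absent u shorter than k has the two distinct absent extensions u x xᵗ and u y xᵗ of length k.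
    exactlyOneAbsent⇒shorter-⊆ : ∀ {x y : A} → x ≢ y → ∀ {k w u} → ExactlyOneAbsent k w → length u < k → u ⊆ w
    exactlyOneAbsent⇒shorter-⊆ {x} {y} x≢y {k} {w} {u} (_ , _ , u₀!) |u|<k = decidable-stable (u ⊆? w) λ u⊈w →
      x≢y (∷-injectiveˡ (++-cancelˡ u _ _ (trans (sym (u₀! (padded-absent x u⊈w))) (u₀! (padded-absent y u⊈w)))))
      where
      t = k ∸ suc (length u)
      length-padded : ∀ z → length (u ++ z ∷ replicate t x) ≡ k
      length-padded z = begin
        length (u ++ z ∷ replicate t x)         ≡⟨ length-++ u ⟩
        length u + suc (length (replicate t x)) ≡⟨ cong (λ n → length u + suc n) (length-replicate t) ⟩
        length u + suc t                        ≡⟨ +-suc (length u) t ⟩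
        suc (length u) + t                      ≡⟨ m+[n∸m]≡n |u|<k ⟩
        k                                       ∎
        where open ≡-Reasoning
      padded-absent : ∀ z → ¬ u ⊆ w → Absent k w (u ++ z ∷ replicate t x)
      padded-absent z u⊈w = length-padded z , u⊈w ∘ ⊆-trans (++⁺ʳ _ ⊆-refl)

  ArchEndingIn : List A → A → Set
  ArchEndingIn C a = Complete C × ∃ λ B → C ≡ B ∷ʳ a × a ∉ B

  arches-complete : ∀ {as ls} → Pointwise ArchEndingIn as ls → All Complete as
  arches-complete []                          = All.[]
  arches-complete ((C-complete , _) ∷ arches) = C-complete All.∷ arches-complete arches

  ⊆-concat-complete : ∀ {as : List (List A)} r {u} → All Complete as → length u ≤ length as → u ⊆ concat as ++ r
  ⊆-concat-complete               r {[]}    _                              _           = minimum _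
  ⊆-concat-complete {as = C ∷ as} r {x ∷ u} (C-complete All.∷ as-complete) (s≤s |u|≤) =
    subst (x ∷ u ⊆_) (sym (++-assoc C (concat as) r))
      (++⁺ (from∈ (C-complete x)) (⊆-concat-complete r as-complete |u|≤))

  lasts-⊆ : ∀ {as ls} → Pointwise ArchEndingIn as ls → ls ⊆ concat as
  lasts-⊆ []                            = minimum _
  lasts-⊆ ((_ , B , refl , _) ∷ arches) = ++⁺ (++⁺ˡ B ⊆-refl) (lasts-⊆ arches)

  lasts∷ʳ⊈ : ∀ {as ls r} {b : A} → Pointwise ArchEndingIn as ls → b ∉ r → ¬ ls ∷ʳ b ⊆ concat as ++ r
  lasts∷ʳ⊈ [] b∉r p = b∉r (to∈ p)
  lasts∷ʳ⊈ {as = _ ∷ as} {a ∷ ls} {r} {b} ((_ , B , refl , a∉B) ∷ arches) b∉r p =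
    lasts∷ʳ⊈ arches b∉r (∷⊆++∷⇒⊆ B a∉B (subst (a ∷ ls ∷ʳ b ⊆_) reassociate p))
    where
    reassociate : ((B ∷ʳ a) ++ concat as) ++ r ≡ B ++ a ∷ concat as ++ r
    reassociate = trans (++-assoc (B ∷ʳ a) (concat as) r) (++-assoc B [ a ] (concat as ++ r))

module _ {σ : ℕ} where

  complete≡true⇔Complete : (w : Word σ) → complete w ≡ true ⇔ Complete w
  complete≡true⇔Complete w = mk⇔
    (λ w-complete x → All.lookup (toWitness w-complete) (∈-allFin x))
    (λ w-complete → fromWitness (All.tabulate λ {x} _ → w-complete x))
    ⇔-∘ ⇔-sym T-≡

  complete≡false⇒¬Complete : (w : Word σ) → complete w ≡ false → ¬ Complete w
  complete≡false⇒¬Complete w w-incomplete w-complete =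
    contradiction (trans (sym (Equivalence.from (complete≡true⇔Complete w) w-complete)) w-incomplete) λ ()

  archLastsGo : Word σ → Word σ → Word σ
  archLastsGo cur []      = []
  archLastsGo cur (a ∷ w) with complete (a ∷ cur)
  ... | true  = a ∷ archLastsGo [] w
  ... | false = archLastsGo (a ∷ cur) w

  archLasts : Word σ → Word σ
  archLasts = archLastsGo []

  archGo-factorisation : ∀ (cur w : Word σ) →
    cur ʳ++ w ≡ concat (proj₁ (archGo cur w)) ++ proj₂ (archGo cur w)
  archGo-factorisation cur []      = refl
  archGo-factorisation cur (a ∷ w) with complete (a ∷ cur)
  ... | true  = begin
    (a ∷ cur) ʳ++ w                                        ≡⟨ ʳ++-defn (a ∷ cur) ⟩
    reverse (a ∷ cur) ++ w                                 ≡⟨ cong (reverse (a ∷ cur) ++_) (archGo-factorisation [] w) ⟩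
    reverse (a ∷ cur) ++ concat (proj₁ (archGo [] w)) ++ proj₂ (archGo [] w)
      ≡⟨ ++-assoc (reverse (a ∷ cur)) (concat (proj₁ (archGo [] w))) _ ⟨
    (reverse (a ∷ cur) ++ concat (proj₁ (archGo [] w))) ++ proj₂ (archGo [] w) ∎
    where open ≡-Reasoning
  ... | false = archGo-factorisation (a ∷ cur) w

module _ {n : ℕ} where

  ¬Complete[] : ¬ Complete {Fin (suc n)} []
  ¬Complete[] []-complete with []-complete zero
  ... | ()

  archGo-arches : ∀ (cur w : Word (suc n)) → ¬ Complete cur →
    Pointwise ArchEndingIn (proj₁ (archGo cur w)) (archLastsGo cur w)
  archGo-arches cur []      _              = []
  archGo-arches cur (a ∷ w) cur-incomplete with complete (a ∷ cur) in complete≡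
  ... | true  = (Any.reverse⁺ ∘ a∷cur-complete , reverse cur , unfold-reverse a cur , a∉cur ∘ Any.reverse⁻)
                ∷ archGo-arches [] w ¬Complete[]
    where
    a∷cur-complete = Equivalence.to (complete≡true⇔Complete (a ∷ cur)) complete≡
    a∉cur = completing-∉ cur-incomplete a∷cur-complete
  ... | false = archGo-arches (a ∷ cur) w (complete≡false⇒¬Complete _ complete≡)

  archGo-rest-incomplete : ∀ (cur w : Word (suc n)) → ¬ Complete cur → ¬ Complete (proj₂ (archGo cur w))
  archGo-rest-incomplete cur []      cur-incomplete = cur-incomplete ∘ (Any.reverse⁻ ∘_)
  archGo-rest-incomplete cur (a ∷ w) cur-incomplete with complete (a ∷ cur) in complete≡
  ... | true  = archGo-rest-incomplete [] w ¬Complete[]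
  ... | false = archGo-rest-incomplete (a ∷ cur) w (complete≡false⇒¬Complete _ complete≡)

  arches-archLasts : ∀ (w : Word (suc n)) → Pointwise ArchEndingIn (arches w) (archLasts w)
  arches-archLasts w = archGo-arches [] w ¬Complete[]

  arch-factorisation : ∀ (w : Word (suc n)) → w ≡ concat (arches w) ++ rest w
  arch-factorisation = archGo-factorisation []

  ∃∉rest : ∀ (w : Word (suc n)) → ∃ (_∉ rest w)
  ∃∉rest w = ¬∀⟶∃¬ (suc n) _ (_∈?ʷ rest w) (archGo-rest-incomplete [] w ¬Complete[])

  length-archLasts : ∀ (w : Word (suc n)) → length (archLasts w) ≡ ι w
  length-archLasts w = sym (Pointwise-length (arches-archLasts w))

  ⊆-if-length≤ι : ∀ {w u : Word (suc n)} → length u ≤ ι w → u ⊆ w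
  ⊆-if-length≤ι {w} {u} |u|≤ι = subst (u ⊆_) (sym (arch-factorisation w))
    (⊆-concat-complete (rest w) (arches-complete (arches-archLasts w)) |u|≤ι)

  archLasts∷ʳ-⊆ : ∀ {w : Word (suc n)} {d} → d ∈ rest w → archLasts w ∷ʳ d ⊆ w
  archLasts∷ʳ-⊆ {w} {d} d∈rest = subst (archLasts w ∷ʳ d ⊆_) (sym (arch-factorisation w))
    (++⁺ (lasts-⊆ (arches-archLasts w)) (from∈ d∈rest))

  archLasts∷ʳ-absent : ∀ {w : Word (suc n)} {d} → d ∉ rest w → Absent (suc (ι w)) w (archLasts w ∷ʳ d)
  archLasts∷ʳ-absent {w} {d} d∉rest =
    trans (length-∷ʳ (archLasts w) d) (cong suc (length-archLasts w)) ,
    lasts∷ʳ⊈ (arches-archLasts w) d∉rest ∘ subst (archLasts w ∷ʳ d ⊆_) (arch-factorisation w)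

  ≤ι-if-universal : ∀ {w : Word (suc n)} {m} → (∀ u → length u ≤ m → u ⊆ w) → m ≤ ι w
  ≤ι-if-universal {w} universal = ≮⇒≥ λ ι<m →
    let (b , b∉rest) = ∃∉rest w
        (|Lb|≡1+ι , Lb⊈) = archLasts∷ʳ-absent b∉rest
    in Lb⊈ (universal (archLasts w ∷ʳ b) (≤-trans (≤-reflexive |Lb|≡1+ι) ι<m))

  ι≤ι-reverse : ∀ (w : Word (suc n)) → ι w ≤ ι (reverse w)
  ι≤ι-reverse w = ≤ι-if-universal λ u |u|≤ι → subst (_⊆ reverse w) (reverse-involutive u)
    (reverse⁺ (⊆-if-length≤ι {w} {reverse u} (≤-trans (≤-reflexive (length-reverse u)) |u|≤ι)))

  ι-reverse : ∀ (w : Word (suc n)) → ι (reverse w) ≡ ι w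
  ι-reverse w = ≤-antisym (subst (λ v → ι (reverse w) ≤ ι v) (reverse-involutive w) (ι≤ι-reverse (reverse w)))
                          (ι≤ι-reverse w)

  -- c ∷ Y is the reversal of the first arch of w^R.
  w′-split : ∀ j (w : Word (suc n)) → ι w ≡ suc j →
    ∃₂ λ c Y → w ≡ w′ (suc (suc j)) w ++ c ∷ Y × c ∉ Y × Complete (c ∷ Y)
  w′-split j w ι≡1+j
    with arches (reverse w) | archLasts (reverse w) | arches-archLasts (reverse w)
       | arch-factorisation (reverse w) | trans (ι-reverse w) ι≡1+j
  ... | C ∷ as | a ∷ _ | (C-complete , B , refl , a∉B) ∷ _ | wᴿ≡ | |as|+1≡j+1 =
    a , reverse B , split , a∉B ∘ Any.reverse⁻ , aBᴿ-complete
    where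
    R = rest (reverse w)
    split : w ≡ reverse (concat (take j as) ++ R) ++ a ∷ reverse B
    split = begin
      w                                         ≡⟨ reverse-involutive w ⟨
      reverse (reverse w)                       ≡⟨ cong reverse wᴿ≡ ⟩
      reverse ((C ++ concat as) ++ R)           ≡⟨ cong reverse (++-assoc C (concat as) R) ⟩
      reverse (C ++ concat as ++ R)             ≡⟨ reverse-++ C (concat as ++ R) ⟩
      reverse (concat as ++ R) ++ reverse C     ≡⟨ cong (reverse (concat as ++ R) ++_) (reverse-++ B [ a ]) ⟩
      reverse (concat as ++ R) ++ a ∷ reverse B
        ≡⟨ cong (λ as → reverse (concat as ++ R) ++ a ∷ reverse B)
                (take-all j as (≤-reflexive (suc-injective |as|+1≡j+1))) ⟨
      reverse (concat (take j as) ++ R) ++ a ∷ reverse B ∎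
      where open ≡-Reasoning
    aBᴿ-complete : Complete (a ∷ reverse B)
    aBᴿ-complete x with ∈-++⁻ B (C-complete x)
    ... | inj₁ x∈B         = there (Any.reverse⁺ x∈B)
    ... | inj₂ (here refl) = here refl

  ∃!∉rest : ∀ {m} {w : Word (suc n)} → ι w ≡ m → ExactlyOneAbsent (suc m) w → ∃! _≡_ (_∉ rest w)
  ∃!∉rest {w = w} refl (_ , _ , u₀!) =
    let (b , b∉rest) = ∃∉rest w
    in b , b∉rest , λ d∉rest → ∷ʳ-injectiveʳ (archLasts w) _
         (trans (sym (u₀! (archLasts∷ʳ-absent b∉rest))) (u₀! (archLasts∷ʳ-absent d∉rest)))

  exactlyOneAbsent-extend : ∀ {m} {w P : Word (suc n)} {c Y} → ι w ≡ m →
    w ≡ P ++ c ∷ Y → Complete (c ∷ Y) →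
    ∃! _≡_ (_∉ rest w) → ExactlyOneAbsent m P → ExactlyOneAbsent (suc m) w
  exactlyOneAbsent-extend {w = w} {P} refl split cY-complete (b , b∉rest , b!) (_ , _ , p₀!) =
    L ∷ʳ b , archLasts∷ʳ-absent b∉rest , unique
    where
    L = archLasts w
    absent-from-P : ∀ {u d} → Absent (suc (ι w)) w (u ∷ʳ d) → Absent (ι w) P u
    absent-from-P = absent-prefix cY-complete ∘ subst (λ v → Absent _ v _) split
    unique : ∀ {v} → Absent (suc (ι w)) w v → L ∷ʳ b ≡ v
    unique {v} v-absent with initLast v
    ... | []       = contradiction (proj₁ v-absent) λ ()
    ... | v′ ∷ʳ′ d = cong₂ _∷ʳ_ L≡v′ (b! d∉rest)
      where
      L≡v′ : L ≡ v′
      L≡v′ = trans (sym (p₀! (absent-from-P (archLasts∷ʳ-absent b∉rest)))) (p₀! (absent-from-P v-absent))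
      d∉rest : d ∉ rest w
      d∉rest d∈rest = proj₂ v-absent (subst (λ u → u ∷ʳ d ⊆ w) L≡v′ (archLasts∷ʳ-⊆ d∈rest))

module _ {n : ℕ} where

  exactlyOneAbsent⇒ι≡ : ∀ {m} {w : Word (suc (suc n))} → ExactlyOneAbsent (suc m) w → ι w ≡ m
  exactlyOneAbsent⇒ι≡ one@(_ , (|u₀|≡1+m , u₀⊈w) , _) = ≤-antisym
    (≮⇒≥ λ m<ι → u₀⊈w (⊆-if-length≤ι (≤-trans (≤-reflexive |u₀|≡1+m) m<ι)))
    (≤ι-if-universal λ u |u|≤m → exactlyOneAbsent⇒shorter-⊆ _≟_ {zero} {suc zero} (λ ()) one (s≤s |u|≤m))

  exactlyOneAbsent⇔ : ∀ j (w : Word (suc (suc n))) →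
    ExactlyOneAbsent (suc (suc j)) w ⇔
    (ι w ≡ suc j × ∃! _≡_ (_∉ rest w) × ExactlyOneAbsent (suc j) (w′ (suc (suc j)) w))
  exactlyOneAbsent⇔ j w = mk⇔ to from
    where
    to : ExactlyOneAbsent (suc (suc j)) w →
         ι w ≡ suc j × ∃! _≡_ (_∉ rest w) × ExactlyOneAbsent (suc j) (w′ (suc (suc j)) w)
    to one with exactlyOneAbsent⇒ι≡ one
    ... | ι≡1+j with w′-split j w ι≡1+j
    ... | _ , _ , split , c∉Y , cY-complete =
      ι≡1+j , ∃!∉rest ι≡1+j one , exactlyOneAbsent-prefix c∉Y cY-complete (subst (ExactlyOneAbsent _) split one)
    from : ι w ≡ suc j × ∃! _≡_ (_∉ rest w) × ExactlyOneAbsent (suc j) (w′ (suc (suc j)) w) →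
           ExactlyOneAbsent (suc (suc j)) w
    from (ι≡1+j , ∃!∉ , one′) with w′-split j w ι≡1+j
    ... | _ , _ , split , _ , cY-complete = exactlyOneAbsent-extend ι≡1+j split cY-complete ∃!∉ one′

mainTheorem10 : (σ : ℕ) → 2 ≤ σ → (k : ℕ) → 2 ≤ k → (w : Word σ) →
    (numScatFact k w ≡ σ ^ k ∸ 1)
    ⇔ ((ι w ≡ k ∸ 1) × (numAlph (rest w) ≡ σ ∸ 1)
    × (numScatFact (k ∸ 1) (w′ k w) ≡ σ ^ (k ∸ 1) ∸ 1))
mainTheorem10 σ@(suc (suc _)) (s≤s (s≤s _)) k@(suc (suc j)) (s≤s (s≤s _)) w = begin
  numScatFact k w ≡ σ ^ k ∸ 1
    ∼⟨ numScatFact≡σ^k∸1⇔exactlyOneAbsent k w ⟩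
  ExactlyOneAbsent k w
    ∼⟨ exactlyOneAbsent⇔ j w ⟩
  (ι w ≡ suc j × ∃! _≡_ (_∉ rest w) × ExactlyOneAbsent (suc j) (w′ k w))
    ∼⟨ ⇔-sym (⇔-id _ ×-⇔ numAlph≡σ∸1⇔∃!∉ (rest w) ×-⇔ numScatFact≡σ^k∸1⇔exactlyOneAbsent (suc j) (w′ k w)) ⟩
  (ι w ≡ suc j × numAlph (rest w) ≡ σ ∸ 1 × numScatFact (suc j) (w′ k w) ≡ σ ^ suc j ∸ 1) ∎
  where open Related.EquationalReasoning
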